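{- Let $\ell$ be a positive integer. (i) $2S(\frac\ell4)-2\le\frac12S(\ell)$ if and only if $\ell\ge4$ is a power of $2$. (ii) $S(\frac\ell2)-1\le\frac12S(\ell)$ if and only if $S(\ell)\le2$ and $\ell$ is even. (iii) There are exactly $2^{S(\ell)}-2$ ordered pairs of positive integers $(\ell_1,\ell_2)$ with $\ell_1+\ell_2=\ell$ and $\frac12S(\ell_1)+\frac12S(\ell_2)\le\frac12S(\ell)$. (iv) If $\ell_1,\ell_2$ are distinct positive integers with $2(\ell_1+\ell_2)=\ell$, then $S(\ell_1)+S(\ell_2)-1\le\frac12S(\ell)$ if and only if $S(\ell_1)=S(\ell_2)=1$ and $S(\ell)=2$. (v) If $\ell_1,\ell_2,\ell_3$ are positive integers, not all distinct, with $\ell_1+\ell_2+\ell_3=\ell$, then it is never the case that $\frac12S(\ell_1)+\frac12S(\ell_2)+\frac12S(\ell_3)\le\frac12S(\ell)$. (vi) If $\ell_1,\ell_2$ are distinct positive integers with $\ell_1+3\ell_2=\ell$, then it is never the case that $\frac12S(\ell_1)+\frac32S(\ell_2)\le\frac12S(\ell)$. (vii) If $\ell_1,\ell_2,\ell_3$ are distinct positive integers with $\ell_1+\ell_2+2\ell_3=\ell$, then it is never the case that $\frac12S(\ell_1)+\frac12S(\ell_2)+S(\ell_3)\le\frac12S(\ell)$. (viii) If $\ell_1,\ell_2,\ell_3,\ell_4$ are distinct nonnegative integers with $\ell_1+\ell_2+\ell_3+\ell_4=\ell$, then it is never the case that $\frac12S(\ell_1)+\frac12S(\ell_2)+\fr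ac12S(\ell_3)+\frac12S(\ell_4)+1\le\frac12S(\ell)$.
   Context: $S(\ell)$ denotes the sum of the digits of the base-$2$ expansion of $\ell$ for $\ell$ a nonnegative integer, and $S(\ell)=\infty$ for $\ell\in\mathbb Q\setminus\{0,1,2,\dots\}$ (so e.g. $S(\ell/4)=\infty$ if $4\nmid\ell$). -}

module Defs where

open import Data.Nat using (ℕ; zero; suc; _+_; _*_; _^_; _≤_)
open import Data.Nat.DivMod using (_/_; _%_)
open import Data.Integer using (ℤ; +_; -[1+_])
open import Data.Rational using (ℚ)
open import Data.Maybe using (Maybe; just; nothing)
open import Data.Product using (∃; Σ; _×_)
open import Relation.Binary.PropositionalEquality using (_≡_)

-- Sum of binary digits of n, computed with fuel: after `fuel` halvings
-- the number is 0 whenever fuel ≥ number of binary digits (fuel = n suffices).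
bitsum : ℕ → ℕ → ℕ
bitsum zero    n = 0
bitsum (suc f) n = n % 2 + bitsum f (n / 2)

S : ℕ → ℕ
S n = bitsum n n

-- Extended S on ℚ: S(q) = S(n) if q is a nonnegative integer n,
-- and ∞ (represented by `nothing`) otherwise.
Sℚ : ℚ → Maybe ℕ
Sℚ q with ℚ.denominator-1 q | ℚ.numerator q
... | zero  | + n      = just (S n)
... | zero  | -[1+ _ ] = nothing
... | suc _ | _        = nothing

IsPow2 : ℕ → Set
IsPow2 ℓ = ∃ λ k → ℓ ≡ 2 ^ k

module Submission where

-- Everything rests on three facts about the binary digit sum S.
--   * The recursion S(2k) = S(k), S(2k+1) = 1 + S(k); it comes with a
--     binary induction principle on ℕ and gives S(m·2^j) = S(m).
--   * Subadditivity S(a + b) ≤ S(a) + S(b), strict when a and b are both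
--     odd (a carry occurs) or when a positive summand is repeated, because
--     S(a + a) = S(a).
--   * Carry-free splittings a + b = ℓ with S(a) + S(b) ≤ S(ℓ) amount to
--     sending each binary one of ℓ to one of the two sides, so there are
--     2^S(ℓ) of them; cancelling the trivial splittings 0 + ℓ and ℓ + 0 from
--     this bijection leaves 2^S(ℓ) − 2 positive ones (part (iii)).

open import Defs
open import Data.Nat using (ℕ; zero; suc; _+_; _*_; _^_; _∸_; _≤_; _<_; z≤n; s≤s; NonZero)
open import Data.Nat.Properties
open import Data.Nat.DivMod
  using (_%_; m/n<m; m*n%n≡0; m*n/n≡m; [m+kn]%n≡m%n; +-distrib-/-∣ʳ) renaming (_/_ to _div_)
open import Data.Nat.Divisibility using (_∣_; divides; divides-refl; ∣-antisym; ∣-refl; n∣m*n)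
open import Data.Nat.GCD using (gcd[m,n]∣n; gcd-greatest)
open import Data.Nat.Induction using (<-rec)
open import Data.Nat.Tactic.RingSolver using (solve-∀)
open import Data.Integer as ℤ using (+_; -[1+_])
import Data.Integer.Properties as ℤₚ
open import Data.Integer.GCD using (gcd)
open import Data.Rational using (ℚ; mkℚ; _/_; ↥_; ↧_)
open import Data.Rational.Properties using (↥-/; ↧-/)
open import Data.Maybe using (Maybe; just; nothing)
open import Data.Fin using (Fin)
open import Data.Fin.Properties using (+↔⊎)
open import Data.Product using (∃; Σ; _×_; _,_; proj₁; proj₂)
open import Data.Sum using (_⊎_; inj₁; inj₂)
open import Data.Sum.Function.Propositional using (_⊎-↔_)
open import Data.Empty using (⊥-elim; ⊥-elim-irr)
open import Function using (_∘_; _⇔_; _↔_; mk⇔; mk↔ₛ′; mk⤖; Equivalence; Inverse)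
open import Function.Definitions using (Injective; StrictlySurjective)
open import Function.Consequences.Propositional using (strictlySurjective⇒surjective)
open import Function.Properties.Bijection using (⤖⇒↔)
open import Function.Properties.Inverse using (↔-trans; ↔-sym)
open import Relation.Binary.PropositionalEquality
open import Relation.Nullary using (¬_)
open import Relation.Nullary.Irrelevant using (Irrelevant)

-- Binary digit sums: the recursion behind S and binary induction.

half≤ : ∀ {n f} → n ≤ suc f → n div 2 ≤ f
half≤ {zero}  _  = z≤n
half≤ {suc n} le = ≤-pred (≤-trans (m/n<m (suc n) 2 (s≤s (s≤s z≤n))) le)

bitsum-fuel : ∀ f g n → n ≤ f → n ≤ g → bitsum f n ≡ bitsum g n
bitsum-fuel zero    zero    n    _  _  = refl
bitsum-fuel zero    (suc g) zero _  _  = bitsum-fuel zero g 0 z≤n z≤n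
bitsum-fuel (suc f) zero    zero _  _  = bitsum-fuel f zero 0 z≤n z≤n
bitsum-fuel (suc f) (suc g) n    nf ng =
  cong (λ rest → n % 2 + rest) (bitsum-fuel f g (n div 2) (half≤ nf) (half≤ ng))

S-step : ∀ n → S n ≡ n % 2 + S (n div 2)
S-step zero    = refl
S-step (suc n) =
  cong (λ rest → suc n % 2 + rest) (bitsum-fuel n (suc n div 2) (suc n div 2) (half≤ ≤-refl) ≤-refl)

S-even : ∀ k → S (k * 2) ≡ S k
S-even k = begin
  S (k * 2)                    ≡⟨ S-step (k * 2) ⟩
  k * 2 % 2 + S (k * 2 div 2)  ≡⟨ cong₂ _+_ (m*n%n≡0 k 2) (cong S (m*n/n≡m k 2)) ⟩
  S k                          ∎
  where open ≡-Reasoning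

S-odd : ∀ k → S (1 + k * 2) ≡ 1 + S k
S-odd k = begin
  S (1 + k * 2)                            ≡⟨ S-step (1 + k * 2) ⟩
  (1 + k * 2) % 2 + S ((1 + k * 2) div 2)  ≡⟨ cong₂ _+_ ([m+kn]%n≡m%n 1 k 2) (cong S half) ⟩
  1 + S k                                  ∎
  where
  open ≡-Reasoning
  half : (1 + k * 2) div 2 ≡ k
  half = trans (+-distrib-/-∣ʳ 1 {d = 2} (divides-refl k)) (m*n/n≡m k 2)

S-digit : ∀ r x → r ≤ 1 → S (r + x * 2) ≡ r + S x
S-digit zero          x _        = S-even x
S-digit (suc zero)    x _        = S-odd x
S-digit (suc (suc r)) x (s≤s ())

data ParityView : ℕ → Set where
  even : ∀ k → ParityView (k * 2)
  odd  : ∀ k → ParityView (1 + k * 2)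

parityView : ∀ n → ParityView n
parityView zero    = even 0
parityView (suc n) with parityView n
... | even k = odd k
... | odd  k = even (suc k)

binary-induction : ∀ {p} (P : ℕ → Set p) → P 0 →
                   (∀ k → P k → P (1 + k * 2)) →
                   (∀ k → P (suc k) → P (suc k * 2)) →
                   ∀ n → P n
binary-induction P base odd-step even-step = <-rec P step
  where
  step : ∀ n → (∀ {m} → m < n → P m) → P n
  step n ih with parityView n
  ... | even zero    = base
  ... | even (suc k) = even-step k (ih (s≤s (s≤s (m≤m*n k 2))))
  ... | odd  k       = odd-step k (ih (s≤s (m≤m*n k 2)))

even+even : ∀ x y → x * 2 + y * 2 ≡ (x + y) * 2
even+even x y = sym (*-distribʳ-+ 2 x y)

even+odd : ∀ x y → x * 2 + (1 + y * 2) ≡ 1 + (x + y) * 2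
even+odd x y = trans (+-suc (x * 2) (y * 2)) (cong suc (even+even x y))

odd+odd : ∀ x y → 1 + x * 2 + (1 + y * 2) ≡ (x + suc y) * 2
odd+odd x y = trans (cong suc (even+odd x y)) (cong (_* 2) (sym (+-suc x y)))

parity-clash : ∀ m n → m * 2 ≢ 1 + n * 2
parity-clash m n eq = even≢odd m n (trans (*-comm 2 m) (trans eq (cong suc (*-comm n 2))))

S-positive : ∀ n → 0 < n → 0 < S n
S-positive = binary-induction (λ n → 0 < n → 0 < S n) (λ ()) odd-case even-case
  where
  odd-case : ∀ k → (0 < k → 0 < S k) → 0 < 1 + k * 2 → 0 < S (1 + k * 2)
  odd-case k _ _ rewrite S-odd k = s≤s z≤n
  even-case : ∀ k → (0 < suc k → 0 < S (suc k)) → 0 < suc k * 2 → 0 < S (suc k * 2)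
  even-case k ih _ rewrite S-even (suc k) = ih (s≤s z≤n)

S-suc : ∀ n → S (suc n) ≤ suc (S n)
S-suc = binary-induction (λ n → S (suc n) ≤ suc (S n)) ≤-refl odd-case even-case
  where
  odd-case : ∀ k → S (suc k) ≤ suc (S k) → S (suc k * 2) ≤ suc (S (1 + k * 2))
  odd-case k ih rewrite S-even (suc k) | S-odd k = m≤n⇒m≤1+n ih
  even-case : ∀ k → S (suc (suc k)) ≤ suc (S (suc k)) → S (1 + suc k * 2) ≤ suc (S (suc k * 2))
  even-case k _ rewrite S-odd (suc k) | S-even (suc k) = ≤-refl

-- The induction steps for subadditivity, by the parities of the summands;
-- `ih` is subadditivity for the halved first summand x.
module _ (x : ℕ) (ih : ∀ b → S (x + b) ≤ S x + S b) where
  open ≤-Reasoning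

  even-+-bound : ∀ b → S (x * 2 + b) ≤ S (x * 2) + S b
  even-+-bound b with parityView b
  ... | even y = begin
    S (x * 2 + y * 2)      ≡⟨ cong S (even+even x y) ⟩
    S ((x + y) * 2)        ≡⟨ S-even (x + y) ⟩
    S (x + y)              ≤⟨ ih y ⟩
    S x + S y              ≡⟨ sym (cong₂ _+_ (S-even x) (S-even y)) ⟩
    S (x * 2) + S (y * 2)  ∎
  ... | odd y = begin
    S (x * 2 + (1 + y * 2))    ≡⟨ cong S (even+odd x y) ⟩
    S (1 + (x + y) * 2)        ≡⟨ S-odd (x + y) ⟩
    1 + S (x + y)              ≤⟨ s≤s (ih y) ⟩
    1 + (S x + S y)            ≡⟨ sym (+-suc (S x) (S y)) ⟩
    S x + (1 + S y)            ≡⟨ sym (cong₂ _+_ (S-even x) (S-odd y)) ⟩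
    S (x * 2) + S (1 + y * 2)  ∎

  -- Two odd summands produce a carry into the second digit.
  odd-odd-bound : ∀ y → S (1 + x * 2 + (1 + y * 2)) ≤ S x + (1 + S y)
  odd-odd-bound y = begin
    S (1 + x * 2 + (1 + y * 2))  ≡⟨ cong S (odd+odd x y) ⟩
    S ((x + suc y) * 2)          ≡⟨ S-even (x + suc y) ⟩
    S (x + suc y)                ≤⟨ ih (suc y) ⟩
    S x + S (suc y)              ≤⟨ +-monoʳ-≤ (S x) (S-suc y) ⟩
    S x + (1 + S y)              ∎

  odd-+-bound : ∀ b → S (1 + x * 2 + b) ≤ S (1 + x * 2) + S b
  odd-+-bound b with parityView b
  ... | even y = begin
    S (1 + x * 2 + y * 2)      ≡⟨ cong (S ∘ suc) (even+even x y) ⟩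
    S (1 + (x + y) * 2)        ≡⟨ S-odd (x + y) ⟩
    1 + S (x + y)              ≤⟨ s≤s (ih y) ⟩
    1 + S x + S y              ≡⟨ sym (cong₂ _+_ (S-odd x) (S-even y)) ⟩
    S (1 + x * 2) + S (y * 2)  ∎
  ... | odd y = begin
    S (1 + x * 2 + (1 + y * 2))    ≤⟨ odd-odd-bound y ⟩
    S x + (1 + S y)                ≤⟨ n≤1+n _ ⟩
    1 + S x + (1 + S y)            ≡⟨ sym (cong₂ _+_ (S-odd x) (S-odd y)) ⟩
    S (1 + x * 2) + S (1 + y * 2)  ∎

-- Subadditivity of the binary digit sum: adding can only create carries.
subadditive : ∀ a b → S (a + b) ≤ S a + S b
subadditive = binary-induction (λ a → ∀ b → S (a + b) ≤ S a + S b)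
  (λ b → ≤-refl) odd-+-bound (λ x → even-+-bound (suc x))

odd-odd-carry : ∀ x y → S (1 + x * 2 + (1 + y * 2)) < S (1 + x * 2) + S (1 + y * 2)
odd-odd-carry x y = subst (S (1 + x * 2 + (1 + y * 2)) <_) (sym (cong₂ _+_ (S-odd x) (S-odd y)))
                          (s≤s (odd-odd-bound x (subadditive x) y))

-- A repeated positive summand always loses digits, as a + a has the digits of a.
S-double : ∀ n → S (2 * n) ≡ S n
S-double n = trans (cong S (*-comm 2 n)) (S-even n)

S-+-self : ∀ n → S (n + n) ≡ S n
S-+-self n = trans (cong (λ m → S (n + m)) (sym (+-identityʳ n))) (S-double n)

repeated-loss : ∀ a c → 1 ≤ a → S (a + a + c) < S a + S a + S c
repeated-loss a c 1≤a = begin-strict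
  S (a + a + c)    ≤⟨ subadditive (a + a) c ⟩
  S (a + a) + S c  ≡⟨ cong (_+ S c) (S-+-self a) ⟩
  S a + S c        <⟨ +-monoˡ-< (S c) (m<n+m (S a) (S-positive a 1≤a)) ⟩
  S a + S a + S c  ∎
  where open ≤-Reasoning

S-shift : ∀ m j → S (m * 2 ^ j) ≡ S m
S-shift m zero    = cong S (*-identityʳ m)
S-shift m (suc j) = begin
  S (m * (2 * 2 ^ j))  ≡⟨ cong S (shift-assoc m (2 ^ j)) ⟩
  S (m * 2 ^ j * 2)    ≡⟨ S-even (m * 2 ^ j) ⟩
  S (m * 2 ^ j)        ≡⟨ S-shift m j ⟩
  S m                  ∎
  where
  open ≡-Reasoning
  shift-assoc : ∀ m p → m * (2 * p) ≡ m * p * 2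
  shift-assoc = solve-∀

S-2^ : ∀ j → S (2 ^ j) ≡ 1
S-2^ j = trans (cong S (sym (*-identityˡ (2 ^ j)))) (S-shift 1 j)

S≡1⇒IsPow2 : ∀ n → S n ≡ 1 → IsPow2 n
S≡1⇒IsPow2 = binary-induction (λ n → S n ≡ 1 → IsPow2 n) (λ ()) odd-case even-case
  where
  odd-case : ∀ k → (S k ≡ 1 → IsPow2 k) → S (1 + k * 2) ≡ 1 → IsPow2 (1 + k * 2)
  odd-case zero    _ _   = 0 , refl
  odd-case (suc k) _ S≡1 = ⊥-elim (<-irrefl (sym (suc-injective (trans (sym (S-odd (suc k))) S≡1)))
                                             (S-positive (suc k) (s≤s z≤n)))
  even-case : ∀ k → (S (suc k) ≡ 1 → IsPow2 (suc k)) → S (suc k * 2) ≡ 1 → IsPow2 (suc k * 2)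
  even-case k ih S≡1 with ih (trans (sym (S-even (suc k))) S≡1)
  ... | j , k+1≡2^j = suc j , trans (cong (_* 2) k+1≡2^j) (*-comm (2 ^ j) 2)

-- The extended digit sum Sℚ on quotients ℓ / d.

Sℚ-just : ∀ q {k} → Sℚ q ≡ just k → ∃ λ n → ↥ q ≡ + n × ↧ q ≡ + 1 × k ≡ S n
Sℚ-just (mkℚ (+ n)    zero    _) refl = n , refl , refl , refl
Sℚ-just (mkℚ -[1+ _ ] zero    _) ()
Sℚ-just (mkℚ _        (suc _) _) ()

Sℚ-integral : ∀ q {n} → ↥ q ≡ + n → ↧ q ≡ + 1 → Sℚ q ≡ just (S n)
Sℚ-integral (mkℚ _ zero    _) refl _ = refl
Sℚ-integral (mkℚ _ (suc _) _) _    ()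

-- Sℚ(ℓ/d) is finite only when d ∣ ℓ, and is then S of the quotient: the
-- reduced form of ℓ/d, scaled by gcd(ℓ, d), gives back ℓ and d.
Sℚ-quotient : ∀ ℓ d .{{_ : NonZero d}} {k} → Sℚ ((+ ℓ) / d) ≡ just k →
              ∃ λ m → ℓ ≡ m * d × k ≡ S m
Sℚ-quotient ℓ d eq with Sℚ-just ((+ ℓ) / d) eq
... | n , ↥q≡n , ↧q≡1 , k≡Sn = n , ℤₚ.+-injective ℓ≡n*d , k≡Sn
  where
  g≡d : gcd (+ ℓ) (+ d) ≡ + d
  g≡d = trans (sym (ℤₚ.*-identityˡ _))
              (subst (λ x → x ℤ.* gcd (+ ℓ) (+ d) ≡ + d) ↧q≡1 (↧-/ (+ ℓ) d))
  ℓ≡n*d : + ℓ ≡ + (n * d)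
  ℓ≡n*d = trans (sym (↥-/ (+ ℓ) d)) (trans (cong₂ ℤ._*_ ↥q≡n g≡d) (sym (ℤₚ.pos-* n d)))

Sℚ-multiple : ∀ m d .{{_ : NonZero d}} → Sℚ ((+ (m * d)) / d) ≡ just (S m)
Sℚ-multiple m d = Sℚ-integral q
  (ℤₚ.*-cancelʳ-≡ (↥ q) (+ m) (+ d)
    (trans (scaled (↥ q) _ (↥-/ (+ (m * d)) d)) (ℤₚ.pos-* m d)))
  (ℤₚ.*-cancelʳ-≡ (↧ q) (+ 1) (+ d)
    (trans (scaled (↧ q) _ (↧-/ (+ (m * d)) d)) (sym (ℤₚ.*-identityˡ (+ d)))))
  where
  q : ℚ
  q = (+ (m * d)) / d
  g≡d : gcd (+ (m * d)) (+ d) ≡ + d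
  g≡d = cong +_ (∣-antisym (gcd[m,n]∣n (m * d) d) (gcd-greatest (n∣m*n m) ∣-refl))
  scaled : ∀ i j → i ℤ.* gcd (+ (m * d)) (+ d) ≡ j → i ℤ.* + d ≡ j
  scaled i j = subst (λ g → i ℤ.* g ≡ j) g≡d

-- Bijections between finite types.

bijection : ∀ {A B : Set} (f : A → B) → Injective _≡_ _≡_ f → StrictlySurjective _≡_ f → A ↔ B
bijection f f-inj f-surj = ⤖⇒↔ (mk⤖ (f-inj , strictlySurjective⇒surjective f-surj))

Σ-≡-irrelevant : ∀ {A : Set} {P : A → Set} → (∀ x → Irrelevant (P x)) →
                 {s t : Σ A P} → proj₁ s ≡ proj₁ t → s ≡ t
Σ-≡-irrelevant irr {x , p} {.x , q} refl = cong (x ,_) (irr x p q)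

Fin-suc : ∀ n → Fin (suc n) ↔ Maybe (Fin n)
Fin-suc n = mk↔ₛ′ to from
  (λ { nothing → refl ; (just i) → refl })
  (λ { Fin.zero → refl ; (Fin.suc i) → refl })
  where
  to : Fin (suc n) → Maybe (Fin n)
  to Fin.zero    = nothing
  to (Fin.suc i) = just i
  from : Maybe (Fin n) → Fin (suc n)
  from nothing  = Fin.zero
  from (just i) = Fin.suc i

private
  just≢nothing : ∀ {A : Set} {a : A} → just a ≢ nothing
  just≢nothing ()

  first-defined : ∀ {B : Set} (x y : Maybe B) → .(x ≢ y) → B
  first-defined (just b) _        _   = b
  first-defined nothing  (just b) _   = b
  first-defined nothing  nothing  x≢y = ⊥-elim-irr (x≢y refl)

  first-defined-just : ∀ {B : Set} {x y : Maybe B} {b} .{x≢y : x ≢ y} →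
                       x ≡ just b → first-defined x y x≢y ≡ b
  first-defined-just refl = refl

  first-defined-nothing : ∀ {B : Set} {x y : Maybe B} {b} .{x≢y : x ≢ y} →
                          x ≡ nothing → y ≡ just b → first-defined x y x≢y ≡ b
  first-defined-nothing refl refl = refl

shrink : ∀ {A B : Set} (f : Maybe A → Maybe B) (g : Maybe B → Maybe A) →
         (∀ x → g (f x) ≡ x) → A → B
shrink f g g∘f a = first-defined (f (just a)) (f nothing) λ eq →
  just≢nothing (trans (sym (g∘f (just a))) (trans (cong g eq) (g∘f nothing)))

shrink-retract : ∀ {A B : Set} (f : Maybe A → Maybe B) g →
                 (g∘f : ∀ x → g (f x) ≡ x) (f∘g : ∀ y → f (g y) ≡ y) →
                 ∀ a → shrink g f f∘g (shrink f g g∘f a) ≡ a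
shrink-retract f g g∘f f∘g a = by-cases (f (just a)) refl (f nothing) refl
  where
  open ≡-Reasoning
  g-back : ∀ {x y} → f x ≡ y → g y ≡ x
  g-back {x} fx≡y = trans (cong g (sym fx≡y)) (g∘f x)

  by-cases : ∀ x → f (just a) ≡ x → ∀ y → f nothing ≡ y →
             shrink g f f∘g (shrink f g g∘f a) ≡ a
  by-cases (just b) fa _ _ = begin
    shrink g f f∘g (shrink f g g∘f a)  ≡⟨ cong (shrink g f f∘g) (first-defined-just fa) ⟩
    shrink g f f∘g b                   ≡⟨ first-defined-just (g-back fa) ⟩
    a                                  ∎
  by-cases nothing fa (just b) f0 = begin
    shrink g f f∘g (shrink f g g∘f a)  ≡⟨ cong (shrink g f f∘g) (first-defined-nothing fa f0) ⟩
    shrink g f f∘g b                   ≡⟨ first-defined-nothing (g-back f0) (g-back fa) ⟩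
    a                                  ∎
  by-cases nothing fa nothing f0 = ⊥-elim (just≢nothing (trans (sym (g-back fa)) (g-back f0)))

Maybe-cancel : ∀ {A B : Set} → Maybe A ↔ Maybe B → A ↔ B
Maybe-cancel F = mk↔ₛ′ (shrink to from strictlyInverseʳ) (shrink from to strictlyInverseˡ)
  (shrink-retract from to strictlyInverseˡ strictlyInverseʳ)
  (shrink-retract to from strictlyInverseʳ strictlyInverseˡ)
  where open Inverse F

-- Carry-free splittings and their count.

Splits : ℕ → ℕ × ℕ → Set
Splits ℓ (a , b) = a + b ≡ ℓ × S a + S b ≤ S ℓ

Splitting : ℕ → Set
Splitting ℓ = Σ (ℕ × ℕ) (Splits ℓ)

Splits-irrelevant : ∀ ℓ z → Irrelevant (Splits ℓ z)
Splits-irrelevant ℓ (a , b) (e , s) (e′ , s′) = cong₂ _,_ (≡-irrelevant e e′) (≤-irrelevant s s′)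

splits-halves : ∀ {r t m} x y → r + t ≤ 1 →
                Splits (r + t + m * 2) (r + x * 2 , t + y * 2) ⇔ Splits m (x , y)
splits-halves {r} {t} {m} x y r+t≤1 = mk⇔
  (λ (e , s) → *-cancelʳ-≡ (x + y) m 2 (+-cancelˡ-≡ (r + t) _ _ (trans (sym sum-eq) e))
             , +-cancelˡ-≤ (r + t) _ _ (subst₂ _≤_ digit-eq S-total s))
  (λ (e , s) → trans sum-eq (cong (λ k → r + t + k * 2) e)
             , subst₂ _≤_ (sym digit-eq) (sym S-total) (+-monoʳ-≤ (r + t) s))
  where
  interchange : ∀ a b c d → a + b + (c + d) ≡ a + c + (b + d)
  interchange = solve-∀
  sum-eq : r + x * 2 + (t + y * 2) ≡ r + t + (x + y) * 2
  sum-eq = trans (interchange r (x * 2) t (y * 2)) (cong (λ z → r + t + z) (sym (*-distribʳ-+ 2 x y)))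
  digit-eq : S (r + x * 2) + S (t + y * 2) ≡ r + t + (S x + S y)
  digit-eq = trans (cong₂ _+_ (S-digit r x (≤-trans (m≤m+n r t) r+t≤1))
                              (S-digit t y (≤-trans (m≤n+m t r) r+t≤1)))
                   (interchange r (S x) t (S y))
  S-total : S (r + t + m * 2) ≡ r + t + S m
  S-total = S-digit (r + t) m r+t≤1

-- Both summands odd: a carry is unavoidable.
no-double-carry : ∀ {ℓ} x y → ¬ Splits ℓ (1 + x * 2 , 1 + y * 2)
no-double-carry {ℓ} x y (e , s) = <-irrefl refl (begin-strict
  S ℓ                           ≡⟨ cong S (sym e) ⟩
  S (1 + x * 2 + (1 + y * 2))   <⟨ odd-odd-carry x y ⟩
  S (1 + x * 2) + S (1 + y * 2) ≤⟨ s ⟩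
  S ℓ                           ∎)
  where open ≤-Reasoning

splitting-even : ∀ m → Splitting m ↔ Splitting (m * 2)
splitting-even m = bijection double double-injective double-surjective
  where
  halves : ∀ x y → Splits (m * 2) (x * 2 , y * 2) ⇔ Splits m (x , y)
  halves x y = splits-halves {0} {0} x y z≤n
  double : Splitting m → Splitting (m * 2)
  double ((x , y) , p) = (x * 2 , y * 2) , Equivalence.from (halves x y) p
  double-injective : Injective _≡_ _≡_ double
  double-injective {(x , y) , _} {(x′ , y′) , _} eq = Σ-≡-irrelevant (Splits-irrelevant m)
    (cong₂ _,_ (*-cancelʳ-≡ x x′ 2 (cong (proj₁ ∘ proj₁) eq))
               (*-cancelʳ-≡ y y′ 2 (cong (proj₂ ∘ proj₁) eq)))
  double-surjective : StrictlySurjective _≡_ double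
  double-surjective ((a , b) , p) with parityView a | parityView b
  ... | even x | even y = ((x , y) , Equivalence.to (halves x y) p) , Σ-≡-irrelevant (Splits-irrelevant _) refl
  ... | odd x  | odd y  = ⊥-elim (no-double-carry x y p)
  ... | even x | odd y  = ⊥-elim (parity-clash m (x + y) (trans (sym (proj₁ p)) (even+odd x y)))
  ... | odd x  | even y = ⊥-elim (parity-clash m (x + y) (trans (sym (proj₁ p)) (cong suc (even+even x y))))

-- The ways to split an odd number 1 + 2m: the final 1 goes to exactly one side.
splitting-odd : ∀ m → (Splitting m ⊎ Splitting m) ↔ Splitting (1 + m * 2)
splitting-odd m = bijection attach attach-injective attach-surjective
  where
  left : ∀ x y → Splits (1 + m * 2) (1 + x * 2 , y * 2) ⇔ Splits m (x , y)
  left x y = splits-halves {1} {0} x y ≤-refl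
  right : ∀ x y → Splits (1 + m * 2) (x * 2 , 1 + y * 2) ⇔ Splits m (x , y)
  right x y = splits-halves {0} {1} x y ≤-refl
  attach : Splitting m ⊎ Splitting m → Splitting (1 + m * 2)
  attach (inj₁ ((x , y) , p)) = (1 + x * 2 , y * 2) , Equivalence.from (left x y) p
  attach (inj₂ ((x , y) , p)) = (x * 2 , 1 + y * 2) , Equivalence.from (right x y) p
  halves-≡ : ∀ {x y x′ y′ : ℕ} → x * 2 ≡ x′ * 2 → y * 2 ≡ y′ * 2 → (x , y) ≡ (x′ , y′)
  halves-≡ {x} {y} {x′} {y′} ex ey = cong₂ _,_ (*-cancelʳ-≡ x x′ 2 ex) (*-cancelʳ-≡ y y′ 2 ey)
  attach-injective : Injective _≡_ _≡_ attach
  attach-injective {inj₁ _} {inj₁ _} eq = cong inj₁ (Σ-≡-irrelevant (Splits-irrelevant m)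
    (halves-≡ (suc-injective (cong (proj₁ ∘ proj₁) eq)) (cong (proj₂ ∘ proj₁) eq)))
  attach-injective {inj₂ _} {inj₂ _} eq = cong inj₂ (Σ-≡-irrelevant (Splits-irrelevant m)
    (halves-≡ (cong (proj₁ ∘ proj₁) eq) (suc-injective (cong (proj₂ ∘ proj₁) eq))))
  attach-injective {inj₁ ((x , _) , _)} {inj₂ ((x′ , _) , _)} eq =
    ⊥-elim (parity-clash x′ x (sym (cong (proj₁ ∘ proj₁) eq)))
  attach-injective {inj₂ ((x , _) , _)} {inj₁ ((x′ , _) , _)} eq =
    ⊥-elim (parity-clash x x′ (cong (proj₁ ∘ proj₁) eq))
  attach-surjective : StrictlySurjective _≡_ attach
  attach-surjective ((a , b) , p) with parityView a | parityView b
  ... | odd x  | even y =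
    inj₁ ((x , y) , Equivalence.to (left x y) p) , Σ-≡-irrelevant (Splits-irrelevant _) refl
  ... | even x | odd y  =
    inj₂ ((x , y) , Equivalence.to (right x y) p) , Σ-≡-irrelevant (Splits-irrelevant _) refl
  ... | odd x  | odd y  = ⊥-elim (no-double-carry x y p)
  ... | even x | even y = ⊥-elim (parity-clash (x + y) m (trans (sym (even+even x y)) (proj₁ p)))

splitting-zero : Fin 1 ↔ Splitting 0
splitting-zero = bijection trivial (λ { {Fin.zero} {Fin.zero} _ → refl }) trivial-surjective
  where
  trivial : Fin 1 → Splitting 0
  trivial _ = (0 , 0) , refl , z≤n
  trivial-surjective : StrictlySurjective _≡_ trivial
  trivial-surjective ((a , b) , a+b≡0 , _) = Fin.zero , Σ-≡-irrelevant (Splits-irrelevant 0)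
    (cong₂ _,_ (sym (m+n≡0⇒m≡0 a a+b≡0)) (sym (m+n≡0⇒n≡0 a a+b≡0)))

-- A number with s binary ones has exactly 2^s carry-free splittings:
-- each one goes to either side.
splitting-count : ∀ ℓ → Fin (2 ^ S ℓ) ↔ Splitting ℓ
splitting-count = binary-induction (λ ℓ → Fin (2 ^ S ℓ) ↔ Splitting ℓ)
  splitting-zero odd-case even-case
  where
  odd-case : ∀ k → Fin (2 ^ S k) ↔ Splitting k → Fin (2 ^ S (1 + k * 2)) ↔ Splitting (1 + k * 2)
  odd-case k ih = subst (λ N → Fin N ↔ Splitting (1 + k * 2)) (sym two-copies)
    (↔-trans +↔⊎ (↔-trans (ih ⊎-↔ ih) (splitting-odd k)))
    where
    two-copies : 2 ^ S (1 + k * 2) ≡ 2 ^ S k + 2 ^ S k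
    two-copies = trans (cong (2 ^_) (S-odd k)) (cong (λ z → 2 ^ S k + z) (+-identityʳ (2 ^ S k)))
  even-case : ∀ k → Fin (2 ^ S (suc k)) ↔ Splitting (suc k) →
              Fin (2 ^ S (suc k * 2)) ↔ Splitting (suc k * 2)
  even-case k ih = subst (λ s → Fin (2 ^ s) ↔ Splitting (suc k * 2)) (sym (S-even (suc k)))
    (↔-trans ih (splitting-even (suc k)))

PositivelySplits : ℕ → ℕ × ℕ → Set
PositivelySplits ℓ (a , b) = 1 ≤ a × 1 ≤ b × a + b ≡ ℓ × S a + S b ≤ S ℓ

PositiveSplitting : ℕ → Set
PositiveSplitting ℓ = Σ (ℕ × ℕ) (PositivelySplits ℓ)

splitting-ends : ∀ n → Splitting (suc n) ↔ Maybe (Maybe (PositiveSplitting (suc n)))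
splitting-ends n = mk↔ₛ′ classify embed classify-embed embed-classify
  where
  ℓ : ℕ
  ℓ = suc n
  embed : Maybe (Maybe (PositiveSplitting ℓ)) → Splitting ℓ
  embed nothing                                    = (0 , ℓ) , refl , ≤-refl
  embed (just nothing)                             = (ℓ , 0) , +-identityʳ ℓ , ≤-reflexive (+-identityʳ (S ℓ))
  embed (just (just ((a , b) , _ , _ , a+b≡ℓ , s))) = (a , b) , a+b≡ℓ , s
  classify : Splitting ℓ → Maybe (Maybe (PositiveSplitting ℓ))
  classify ((zero  , _)     , _)         = nothing
  classify ((suc a , zero)  , _)         = just nothing
  classify ((suc a , suc b) , a+b≡ℓ , s) =
    just (just ((suc a , suc b) , s≤s z≤n , s≤s z≤n , a+b≡ℓ , s))
  classify-embed : ∀ x → classify (embed x) ≡ x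
  classify-embed nothing                                           = refl
  classify-embed (just nothing)                                    = refl
  classify-embed (just (just ((suc a , suc b) , s≤s z≤n , s≤s z≤n , _))) = refl
  embed-classify : ∀ s → embed (classify s) ≡ s
  embed-classify ((zero  , b)     , a+b≡ℓ , _) =
    Σ-≡-irrelevant (Splits-irrelevant ℓ) (cong (0 ,_) (sym a+b≡ℓ))
  embed-classify ((suc a , zero)  , a+b≡ℓ , _) =
    Σ-≡-irrelevant (Splits-irrelevant ℓ) (cong (_, 0) (sym (trans (sym (+-identityʳ (suc a))) a+b≡ℓ)))
  embed-classify ((suc a , suc b) , _)         = refl

positive-splitting-count : ∀ n → Fin (2 ^ S (suc n) ∸ 2) ↔ PositiveSplitting (suc n)
positive-splitting-count n =
  Maybe-cancel (↔-trans (↔-sym (Fin-suc K))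
                        (Maybe-cancel (↔-trans (↔-sym (Fin-suc (suc K))) all-splittings)))
  where
  K : ℕ
  K = 2 ^ S (suc n) ∸ 2
  2+K≡2^s : 2 + K ≡ 2 ^ S (suc n)
  2+K≡2^s = m+[n∸m]≡n (two≤2^ (S-positive (suc n) (s≤s z≤n)))
    where
    two≤2^ : ∀ {s} → 0 < s → 2 ≤ 2 ^ s
    two≤2^ {suc s} _ = *-monoʳ-≤ 2 (m^n>0 2 s)
  all-splittings : Fin (2 + K) ↔ Maybe (Maybe (PositiveSplitting (suc n)))
  all-splittings = subst (λ N → Fin N ↔ Maybe (Maybe (PositiveSplitting (suc n)))) (sym 2+K≡2^s)
                         (↔-trans (splitting-count (suc n)) (splitting-ends n))

scaled-bound : ∀ c k d → suc c * k ≤ k + d ⇔ c * k ≤ d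
scaled-bound c k d = mk⇔ (+-cancelˡ-≤ k _ _) (+-monoʳ-≤ k)

-- Part (i): 2S(ℓ/4) − 2 ≤ S(ℓ)/2 (denominators cleared) iff ℓ ≥ 4 is a power of two.
-- S(ℓ/4) is finite only for ℓ = 4m, and then S(ℓ) = S(m), so the bound says S(ℓ) ≤ 1.
quarter-criterion : ∀ ℓ → 1 ≤ ℓ →
  (∃ λ k → Sℚ ((+ ℓ) / 4) ≡ just k × 4 * k ≤ S ℓ + 4) ⇔ (4 ≤ ℓ × IsPow2 ℓ)
quarter-criterion ℓ 1≤ℓ = mk⇔ forward backward
  where
  forward : (∃ λ k → Sℚ ((+ ℓ) / 4) ≡ just k × 4 * k ≤ S ℓ + 4) → 4 ≤ ℓ × IsPow2 ℓ
  forward (k , Sℓ/4≡k , bound) with Sℚ-quotient ℓ 4 Sℓ/4≡k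
  ... | zero  , refl , _    = ⊥-elim (<-irrefl refl 1≤ℓ)
  ... | suc m , refl , refl = m≤m+n 4 (m * 4) , S≡1⇒IsPow2 ℓ (≤-antisym Sℓ≤1 (S-positive ℓ 1≤ℓ))
    where
    Sℓ≡Sm : S ℓ ≡ S (suc m)
    Sℓ≡Sm = S-shift (suc m) 2
    3Sℓ≤4 : 3 * S ℓ ≤ 4
    3Sℓ≤4 = Equivalence.to (scaled-bound 3 (S ℓ) 4) (subst (λ s → 4 * s ≤ S ℓ + 4) (sym Sℓ≡Sm) bound)
    Sℓ≤1 : S ℓ ≤ 1
    Sℓ≤1 = ≤-pred (*-cancelˡ-< 3 (S ℓ) 2 (s≤s (m≤n⇒m≤1+n 3Sℓ≤4)))
  backward : 4 ≤ ℓ × IsPow2 ℓ → ∃ λ k → Sℚ ((+ ℓ) / 4) ≡ just k × 4 * k ≤ S ℓ + 4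
  backward (4≤ℓ , j , refl) = power-case j 4≤ℓ
    where
    power-case : ∀ j → 4 ≤ 2 ^ j → ∃ λ k → Sℚ ((+ (2 ^ j)) / 4) ≡ just k × 4 * k ≤ S (2 ^ j) + 4
    power-case zero          (s≤s ())
    power-case (suc zero)    (s≤s (s≤s ()))
    power-case (suc (suc i)) _ =
      S (2 ^ i) ,
      subst (λ n → Sℚ ((+ n) / 4) ≡ just (S (2 ^ i))) (four-times (2 ^ i)) (Sℚ-multiple (2 ^ i) 4) ,
      subst₂ (λ s t → 4 * s ≤ t + 4) (sym (S-2^ i)) (sym (S-2^ (2 + i))) (m≤n+m 4 1)
      where
      four-times : ∀ p → p * 4 ≡ 2 * (2 * p)
      four-times = solve-∀

twice-bound : ∀ s → 2 * s ≤ s + 2 ⇔ s ≤ 2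
twice-bound s = mk⇔ (λ h → subst (_≤ 2) (+-identityʳ s) (Equivalence.to (scaled-bound 1 s 2) h))
                    (λ h → Equivalence.from (scaled-bound 1 s 2) (subst (_≤ 2) (sym (+-identityʳ s)) h))

half-criterion : ∀ ℓ →
  (∃ λ k → Sℚ ((+ ℓ) / 2) ≡ just k × 2 * k ≤ S ℓ + 2) ⇔ (S ℓ ≤ 2 × 2 ∣ ℓ)
half-criterion ℓ = mk⇔ forward backward
  where
  forward : (∃ λ k → Sℚ ((+ ℓ) / 2) ≡ just k × 2 * k ≤ S ℓ + 2) → S ℓ ≤ 2 × 2 ∣ ℓ
  forward (k , Sℓ/2≡k , bound) with Sℚ-quotient ℓ 2 Sℓ/2≡k
  ... | m , refl , refl =
    Equivalence.to (twice-bound (S ℓ)) (subst (λ s → 2 * s ≤ S ℓ + 2) (sym (S-even m)) bound) ,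
    divides m refl
  backward : S ℓ ≤ 2 × 2 ∣ ℓ → ∃ λ k → Sℚ ((+ ℓ) / 2) ≡ just k × 2 * k ≤ S ℓ + 2
  backward (Sℓ≤2 , divides m refl) =
    S m , Sℚ-multiple m 2 ,
    subst (λ s → 2 * s ≤ S ℓ + 2) (S-even m) (Equivalence.from (twice-bound (S ℓ)) Sℓ≤2)

unit-pair : ∀ {u v w} → 1 ≤ u → 1 ≤ v → w ≤ u + v → 2 * (u + v) ≤ w + 2 →
            u ≡ 1 × v ≡ 1 × w ≡ 2
unit-pair {u} {v} {w} 1≤u 1≤v w≤u+v h with ≤-antisym u≤1 1≤u | ≤-antisym v≤1 1≤v
  where
  u+v≤2 : u + v ≤ 2
  u+v≤2 = Equivalence.to (twice-bound (u + v)) (≤-trans h (+-monoˡ-≤ 2 w≤u+v))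
  u≤1 : u ≤ 1
  u≤1 = +-cancelʳ-≤ 1 u 1 (≤-trans (+-monoʳ-≤ u 1≤v) u+v≤2)
  v≤1 : v ≤ 1
  v≤1 = ≤-pred (≤-trans (+-monoˡ-≤ v 1≤u) u+v≤2)
... | refl | refl = refl , refl , ≤-antisym w≤u+v (+-cancelʳ-≤ 2 2 w h)

-- Part (iv): for ℓ = 2(a + b), S(a) + S(b) − 1 ≤ S(ℓ)/2 iff S(a) = S(b) = 1 and S(ℓ) = 2,
-- since S(ℓ) = S(a + b) ≤ S(a) + S(b).
double-sum-criterion : ∀ ℓ a b → 1 ≤ a → 1 ≤ b → 2 * (a + b) ≡ ℓ →
  (2 * (S a + S b) ≤ S ℓ + 2) ⇔ (S a ≡ 1 × S b ≡ 1 × S ℓ ≡ 2)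
double-sum-criterion ℓ a b 1≤a 1≤b refl = mk⇔
  (unit-pair (S-positive a 1≤a) (S-positive b 1≤b) Sℓ≤Sa+Sb)
  (λ { (Sa≡1 , Sb≡1 , Sℓ≡2) → subst₂ (λ x y → 2 * (x + y) ≤ S ℓ + 2) (sym Sa≡1) (sym Sb≡1)
                                 (≤-reflexive (cong (_+ 2) (sym Sℓ≡2))) })
  where
  Sℓ≤Sa+Sb : S (2 * (a + b)) ≤ S a + S b
  Sℓ≤Sa+Sb = subst (_≤ S a + S b) (sym (S-double (a + b))) (subadditive a b)

no-repeated-triple : ∀ ℓ a b c → 1 ≤ a → 1 ≤ b → (a ≡ b ⊎ b ≡ c ⊎ a ≡ c) → a + b + c ≡ ℓ →
                     ¬ (S a + S b + S c ≤ S ℓ)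
no-repeated-triple _ a _ c 1≤a _ (inj₁ refl) refl = <⇒≱ (repeated-loss a c 1≤a)
no-repeated-triple _ a b _ _ 1≤b (inj₂ (inj₁ refl)) refl =
  <⇒≱ (subst₂ _<_ (cong S (rotate b a)) (rotate (S b) (S a)) (repeated-loss b a 1≤b))
  where
  rotate : ∀ x y → x + x + y ≡ y + x + x
  rotate = solve-∀
no-repeated-triple _ a b _ 1≤a _ (inj₂ (inj₂ refl)) refl =
  <⇒≱ (subst₂ _<_ (cong S (swap a b)) (swap (S a) (S b)) (repeated-loss a b 1≤a))
  where
  swap : ∀ x y → x + x + y ≡ x + y + x
  swap = solve-∀

no-tripled-part : ∀ ℓ a b → 1 ≤ b → a + 3 * b ≡ ℓ → ¬ (S a + 3 * S b ≤ S ℓ)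
no-tripled-part _ a b 1≤b refl = <⇒≱ (begin-strict
  S (a + 3 * b)               ≡⟨ cong S (regroup a b) ⟩
  S (b + b + (a + b))         <⟨ repeated-loss b (a + b) 1≤b ⟩
  S b + S b + S (a + b)       ≤⟨ +-monoʳ-≤ (S b + S b) (subadditive a b) ⟩
  S b + S b + (S a + S b)     ≡⟨ sym (regroup (S a) (S b)) ⟩
  S a + 3 * S b               ∎)
  where
  open ≤-Reasoning
  regroup : ∀ x y → x + 3 * y ≡ y + y + (x + y)
  regroup = solve-∀

no-doubled-part : ∀ ℓ a b c → 1 ≤ c → a + b + 2 * c ≡ ℓ → ¬ (S a + S b + 2 * S c ≤ S ℓ)
no-doubled-part _ a b c 1≤c refl = <⇒≱ (begin-strict
  S (a + b + 2 * c)           ≡⟨ cong S (regroup a b c) ⟩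
  S (c + c + (a + b))         <⟨ repeated-loss c (a + b) 1≤c ⟩
  S c + S c + S (a + b)       ≤⟨ +-monoʳ-≤ (S c + S c) (subadditive a b) ⟩
  S c + S c + (S a + S b)     ≡⟨ sym (regroup (S a) (S b) (S c)) ⟩
  S a + S b + 2 * S c         ∎)
  where
  open ≤-Reasoning
  regroup : ∀ x y z → x + y + 2 * z ≡ z + z + (x + y)
  regroup = solve-∀

no-quadruple-gain : ∀ ℓ a b c d → a + b + c + d ≡ ℓ → ¬ (S a + S b + S c + S d + 2 ≤ S ℓ)
no-quadruple-gain _ a b c d refl = <⇒≱ (begin-strict
  S (a + b + c + d)           ≤⟨ subadditive (a + b + c) d ⟩
  S (a + b + c) + S d         ≤⟨ +-monoˡ-≤ (S d) (subadditive (a + b) c) ⟩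
  S (a + b) + S c + S d       ≤⟨ +-monoˡ-≤ (S d) (+-monoˡ-≤ (S c) (subadditive a b)) ⟩
  S a + S b + S c + S d       <⟨ m<m+n _ (s≤s z≤n) ⟩
  S a + S b + S c + S d + 2   ∎)
  where open ≤-Reasoning

lemma4 : (ℓ : ℕ) → 1 ≤ ℓ →
    ((∃ λ k → Sℚ ((+ ℓ) / 4) ≡ just k × 4 * k ≤ S ℓ + 4) ⇔ (4 ≤ ℓ × IsPow2 ℓ))
    × ((∃ λ k → Sℚ ((+ ℓ) / 2) ≡ just k × 2 * k ≤ S ℓ + 2) ⇔ (S ℓ ≤ 2 × 2 ∣ ℓ))
    × (Fin (2 ^ S ℓ ∸ 2) ↔
        Σ (ℕ × ℕ) (λ { (ℓ₁ , ℓ₂) → 1 ≤ ℓ₁ × 1 ≤ ℓ₂ × ℓ₁ + ℓ₂ ≡ ℓ × S ℓ₁ + S ℓ₂ ≤ S ℓ }))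
    × (∀ ℓ₁ ℓ₂ → 1 ≤ ℓ₁ → 1 ≤ ℓ₂ → ℓ₁ ≢ ℓ₂ → 2 * (ℓ₁ + ℓ₂) ≡ ℓ →
        ((2 * (S ℓ₁ + S ℓ₂) ≤ S ℓ + 2) ⇔ (S ℓ₁ ≡ 1 × S ℓ₂ ≡ 1 × S ℓ ≡ 2)))
    × (∀ ℓ₁ ℓ₂ ℓ₃ → 1 ≤ ℓ₁ → 1 ≤ ℓ₂ → 1 ≤ ℓ₃ →
        (ℓ₁ ≡ ℓ₂ ⊎ ℓ₂ ≡ ℓ₃ ⊎ ℓ₁ ≡ ℓ₃) → ℓ₁ + ℓ₂ + ℓ₃ ≡ ℓ →
        ¬ (S ℓ₁ + S ℓ₂ + S ℓ₃ ≤ S ℓ))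
    × (∀ ℓ₁ ℓ₂ → 1 ≤ ℓ₁ → 1 ≤ ℓ₂ → ℓ₁ ≢ ℓ₂ → ℓ₁ + 3 * ℓ₂ ≡ ℓ →
        ¬ (S ℓ₁ + 3 * S ℓ₂ ≤ S ℓ))
    × (∀ ℓ₁ ℓ₂ ℓ₃ → 1 ≤ ℓ₁ → 1 ≤ ℓ₂ → 1 ≤ ℓ₃ →
        ℓ₁ ≢ ℓ₂ → ℓ₁ ≢ ℓ₃ → ℓ₂ ≢ ℓ₃ → ℓ₁ + ℓ₂ + 2 * ℓ₃ ≡ ℓ →
        ¬ (S ℓ₁ + S ℓ₂ + 2 * S ℓ₃ ≤ S ℓ))
    × (∀ ℓ₁ ℓ₂ ℓ₃ ℓ₄ →
        ℓ₁ ≢ ℓ₂ → ℓ₁ ≢ ℓ₃ → ℓ₁ ≢ ℓ₄ → ℓ₂ ≢ ℓ₃ → ℓ₂ ≢ ℓ₄ → ℓ₃ ≢ ℓ₄ →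
        ℓ₁ + ℓ₂ + ℓ₃ + ℓ₄ ≡ ℓ →
        ¬ (S ℓ₁ + S ℓ₂ + S ℓ₃ + S ℓ₄ + 2 ≤ S ℓ))
lemma4 ℓ@(suc n) 1≤ℓ =
    quarter-criterion ℓ 1≤ℓ
  , half-criterion ℓ
  , positive-splitting-count n
  , (λ a b 1≤a 1≤b _ → double-sum-criterion ℓ a b 1≤a 1≤b)
  , (λ a b c 1≤a 1≤b _ → no-repeated-triple ℓ a b c 1≤a 1≤b)
  , (λ a b _ 1≤b _ → no-tripled-part ℓ a b 1≤b)
  , (λ a b c _ _ 1≤c _ _ _ → no-doubled-part ℓ a b c 1≤c)
  , (λ a b c d _ _ _ _ _ _ → no-quadruple-gain ℓ a b c d)
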